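{- Conditional bisimilarity $\simeq_C$ is a conditional congruence, i.e. it is reflexive ($(a,a,\mathcal C)\in{\simeq_C}$ for all $a\colon 0\to J$ and conditions $\mathcal C$ over $J$), symmetric ($(a,b,\mathcal C)\in{\simeq_C}$ implies $(b,a,\mathcal C)\in{\simeq_C}$), transitive ($(a,b,\mathcal C),(b,c,\mathcal C)\in{\simeq_C}$ implies $(a,c,\mathcal C)\in{\simeq_C}$) and closed under contextualization ($(a,b,\mathcal C)\in{\simeq_C}$ with $a,b\colon0\to J$ implies $(a;d,b;d,\mathcal C_{\downarrow d})\in{\simeq_C}$ for every $d\colon J\to K$).
   Context: Composition of $f\colon A\to B$, $g\colon B\to C$ is written $f;g$. Fix a category $\mathbf C$ with distinguished object $0$ and a representative class $\kappa$ of commuting squares: for every commuting square $\alpha_1;\delta_1=\alpha_2;\delta_2$ there are $(\alpha_1,\alpha_2,\beta_1,\beta_2)\in\kappa$ (a commuting square) and $\gamma$ with $\delta_1=\beta_1;\gamma$, $\delta_2=\beta_2;\gamma$; $\kappa(\alpha_1,\alpha_2)$ is the set of $(\beta_1,\beta_2)$ with $(\alpha_1,\alpha_2,\beta_1,\beta_2)\in\kappa$. Conditions over $A$ are defined inductively as $(A,\mathcal Q,S)$, $\mathcal Q\in\{\forall,\exists\}$, $S$ a finite set of pairs $(h,\mathcal A')$ with $h\colon A\to A'$, $\mathcal A'$ a condition over $A'$. For $a\colon A\to B$: $a\models(A,\forall,S)$ iff for all $(h,\mathcal A')\in S$ and all $g$ with $a=h;g$, $g\models\mathcal A'$; $a\models(A,\exists,S)$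 iff some $(h,\mathcal A')\in S$ and $g$ satisfy $a=h;g$, $g\models\mathcal A'$. $\mathcal A\models\mathcal B$: every arrow satisfying $\mathcal A$ satisfies $\mathcal B$. Boolean connectives have the standard semantics. Shift along $c\colon A\to B$: $(A,\mathcal Q,S)_{\downarrow c}=(B,\mathcal Q,\{(\beta,\mathcal A'_{\downarrow\alpha})\mid(h,\mathcal A')\in S,(\alpha,\beta)\in\kappa(h,c)\})$; it satisfies $c;d\models\mathcal A\iff d\models\mathcal A_{\downarrow c}$. A conditional reactive system is a set $\mathcal S$ of rules $(\ell,r,\mathcal R)$, $\ell,r\colon0\to I$, $\mathcal R$ a condition over $I$. Context step $a\xrightarrow[C]{f,\ \mathcal A}a'$ ($a\colon0\to J$, $f\colon J\to K$, $a'\colon0\to K$, $\mathcal A$ over $K$): there are a rule $(\ell,r,\mathcal R)\in\mathcal S$ and $c\colon I\to K$ with $a;f=\ell;c$, $a'=r;c$, $\mathcal A\models\mathcal R_{\downarrow c}$. A conditional relation is a set of triples $(a,b,\mathcal C)$ with $a,b\colon0\to J$ and $\mathcal C$ a condition over $J$. $\mathcal D\models\bigvee_{i\in I}\mathcal E_i$ (possibly infinite $I$) means every arrow satisfying $\mathcal D$ satisfies some $\mathcal E_i$. A conditional bisimulation is a conditional relation $R$ such that for each $(a,b,\mathcal C)\in R$ and each context step $a\xrightarrow[C]{f,\ \mathcal A}a'$ there are a (possibly infinite) index set $I$, context steps $b\xrightarrow[C]{f,\ \mathcal B_i}b'_i$ and conditions $\mathcal C'_i$ with $(a',b'_i,\mathcal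 C'_i)\in R$ and $\mathcal A\land\mathcal C_{\downarrow f}\models\bigvee_{i\in I}(\mathcal C'_i\land\mathcal B_i)$; and symmetrically for context steps of $b$ answered by context steps of $a$. Conditional bisimilarity $\simeq_C$ is the set of triples contained in some conditional bisimulation. -}

module Defs where

open import Data.Product using (Σ; _×_; _,_; ∃)
open import Data.Sum using (_⊎_)
open import Data.Unit using (⊤)
open import Data.Empty using (⊥)
open import Data.List using (List; []; _∷_; _++_)
open import Data.List.Membership.Propositional using (_∈_)
open import Relation.Binary.PropositionalEquality using (_≡_)

data Quant : Set where
  ∀q ∃q : Quant

-- A category (composition written in diagrammatic order f ; g),
-- with a distinguished object 𝟘, a representative class κ of commuting
-- squares (κ α₁ α₂ is the finite list of pairs (β₁ , β₂), with common
-- codomain D, such that (α₁,α₂,β₁,β₂) ∈ κ), and a set of rules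
-- (given as a predicate).
record Category : Set₁ where
  infixl 20 _⨾_
  field
    Obj   : Set
    Hom   : Obj → Obj → Set
    idA   : ∀ {A} → Hom A A
    _⨾_   : ∀ {A B C} → Hom A B → Hom B C → Hom A C
    assoc : ∀ {A B C D} (f : Hom A B) (g : Hom B C) (h : Hom C D) →
            (f ⨾ g) ⨾ h ≡ f ⨾ (g ⨾ h)
    idˡ   : ∀ {A B} (f : Hom A B) → idA ⨾ f ≡ f
    idʳ   : ∀ {A B} (f : Hom A B) → f ⨾ idA ≡ f
    𝟘     : Obj

module Conditions (𝒞 : Category) where
  open Category 𝒞

  -- Conditions over A: (A, Q, S) with S a finite set (list) of pairs (h, A')
  data Cond (A : Obj) : Set where
    cond : Quant → List (Σ Obj λ A' → Hom A A' × Cond A') → Cond A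

  Branches : Obj → Set
  Branches A = List (Σ Obj λ A' → Hom A A' × Cond A')

  mutual
    _⊨_ : ∀ {A B} → Hom A B → Cond A → Set
    a ⊨ cond ∀q S = ⊨∀ a S
    a ⊨ cond ∃q S = ⊨∃ a S

    ⊨∀ : ∀ {A B} → Hom A B → Branches A → Set
    ⊨∀ a [] = ⊤
    ⊨∀ {B = B} a ((A' , h , 𝒜') ∷ S) =
      ((g : Hom A' B) → a ≡ h ⨾ g → g ⊨ 𝒜') × ⊨∀ a S

    ⊨∃ : ∀ {A B} → Hom A B → Branches A → Set
    ⊨∃ a [] = ⊥
    ⊨∃ {B = B} a ((A' , h , 𝒜') ∷ S) =
      (Σ (Hom A' B) λ g → a ≡ h ⨾ g × g ⊨ 𝒜') ⊎ ⊨∃ a S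

  _⊫_ : ∀ {A} → Cond A → Cond A → Set
  _⊫_ {A} 𝒜 ℬ = ∀ {B} (a : Hom A B) → a ⊨ 𝒜 → a ⊨ ℬ

record Setting : Set₁ where
  field
    cat : Category
  open Category cat
  open Conditions cat
  field
    κ : ∀ {A B₁ B₂} → Hom A B₁ → Hom A B₂ → List (Σ Obj λ D → Hom B₁ D × Hom B₂ D)
    κ-commutes : ∀ {A B₁ B₂} (α₁ : Hom A B₁) (α₂ : Hom A B₂) {D} {β₁ : Hom B₁ D} {β₂ : Hom B₂ D} →
                 (D , β₁ , β₂) ∈ κ α₁ α₂ → α₁ ⨾ β₁ ≡ α₂ ⨾ β₂
    κ-represents : ∀ {A B₁ B₂ E} (α₁ : Hom A B₁) (α₂ : Hom A B₂) (δ₁ : Hom B₁ E) (δ₂ : Hom B₂ E) →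
                   α₁ ⨾ δ₁ ≡ α₂ ⨾ δ₂ →
                   Σ Obj λ D → Σ (Hom B₁ D) λ β₁ → Σ (Hom B₂ D) λ β₂ →
                     (D , β₁ , β₂) ∈ κ α₁ α₂ × (Σ (Hom D E) λ γ → δ₁ ≡ β₁ ⨾ γ × δ₂ ≡ β₂ ⨾ γ)
    Rule : ∀ {I} → Hom 𝟘 I → Hom 𝟘 I → Cond I → Set

module Theory (𝒮 : Setting) where
  open Setting 𝒮
  open Category cat public
  open Conditions cat public

  mutual
    _↓_ : ∀ {A B} → Cond A → Hom A B → Cond B
    cond Q S ↓ c = cond Q (shiftB S c)

    shiftB : ∀ {A B} → Branches A → Hom A B → Branches B
    shiftB [] c = []
    shiftB ((A' , h , 𝒜') ∷ S) c = shiftκ 𝒜' (κ h c) ++ shiftB S c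

    shiftκ : ∀ {A' B} → Cond A' → List (Σ Obj λ D → Hom A' D × Hom B D) → Branches B
    shiftκ 𝒜' [] = []
    shiftκ 𝒜' ((D , α , β) ∷ ks) = (D , β , 𝒜' ↓ α) ∷ shiftκ 𝒜' ks

  Step : ∀ {J K} → Hom 𝟘 J → Hom J K → Cond K → Hom 𝟘 K → Set
  Step {J} {K} a f 𝒜 a' =
    Σ Obj λ I → Σ (Hom 𝟘 I) λ ℓ → Σ (Hom 𝟘 I) λ r → Σ (Cond I) λ ℛ →
      Rule ℓ r ℛ × (Σ (Hom I K) λ c → (a ⨾ f ≡ ℓ ⨾ c) × (a' ≡ r ⨾ c) × (𝒜 ⊫ (ℛ ↓ c)))

  CondRel : Set₁
  CondRel = ∀ {J} → Hom 𝟘 J → Hom 𝟘 J → Cond J → Set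

  -- one half of the bisimulation game: every step of a is answered by a
  -- (possibly infinite) family of steps of b.
  -- 𝒜 ∧ 𝒞↓f ⊨ ⋁ᵢ (𝒞'ᵢ ∧ ℬᵢ)  is spelled out with the standard semantics.
  Answers : CondRel → ∀ {J} → Hom 𝟘 J → Hom 𝟘 J → Cond J → Set₁
  Answers R {J} a b 𝒞 =
    ∀ {K} (f : Hom J K) (𝒜 : Cond K) (a' : Hom 𝟘 K) → Step a f 𝒜 a' →
      Σ Set λ Idx →
      Σ (Idx → Hom 𝟘 K) λ b' → Σ (Idx → Cond K) λ ℬ → Σ (Idx → Cond K) λ 𝒞' →
        ((i : Idx) → Step b f (ℬ i) (b' i)) ×
        ((i : Idx) → R a' (b' i) (𝒞' i)) ×
        (∀ {B} (k : Hom K B) → k ⊨ 𝒜 → k ⊨ (𝒞 ↓ f) →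
           Σ Idx λ i → k ⊨ 𝒞' i × k ⊨ ℬ i)

  IsCondBisim : CondRel → Set₁
  IsCondBisim R = ∀ {J} (a b : Hom 𝟘 J) (𝒞 : Cond J) → R a b 𝒞 →
    Answers R a b 𝒞 × Answers (λ x y z → R y x z) b a 𝒞

  _≃C_∣_ : ∀ {J} → Hom 𝟘 J → Hom 𝟘 J → Cond J → Set₁
  a ≃C b ∣ 𝒞 = Σ CondRel λ R → IsCondBisim R × R a b 𝒞

  record IsCondCongruence : Set₁ where
    field
      refl′  : ∀ {J} (a : Hom 𝟘 J) (𝒞 : Cond J) → a ≃C a ∣ 𝒞
      sym′   : ∀ {J} (a b : Hom 𝟘 J) (𝒞 : Cond J) → a ≃C b ∣ 𝒞 → b ≃C a ∣ 𝒞
      trans′ : ∀ {J} (a b c : Hom 𝟘 J) (𝒞 : Cond J) →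
               a ≃C b ∣ 𝒞 → b ≃C c ∣ 𝒞 → a ≃C c ∣ 𝒞
      ctx    : ∀ {J K} (a b : Hom 𝟘 J) (𝒞 : Cond J) (d : Hom J K) →
               a ≃C b ∣ 𝒞 → (a ⨾ d) ≃C (b ⨾ d) ∣ (𝒞 ↓ d)

-- The proof has two layers.  The first is about conditions alone: the shift
-- 𝒜 ↓ c is correct, i.e.  c ⨾ d ⊨ 𝒜  iff  d ⊨ 𝒜 ↓ c  (by induction on 𝒜,
-- using that κ represents all commuting squares); hence shifting preserves
-- entailment and (𝒜 ↓ d) ↓ f entails 𝒜 ↓ (d ⨾ f).
--
-- The second layer is about the bisimulation game.  A `Reply' packages one
-- answer to a context step (the indexed family of answering steps, their
-- residual conditions and the covering entailment).  Replies can be mapped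
-- along inclusions of relations, composed (giving residuals 𝒞'ᵢ ∧ 𝒞''ᵢⱼ),
-- and moved into a context d.  From this: the identity relation is a
-- bisimulation (reflexivity), the converse of a bisimulation is one
-- (symmetry), the relational composition up to entailment of two
-- bisimulations is one (transitivity), and the closure of a bisimulation
-- under contextualization is one (closure under contexts).
module Submission where

open import Defs
open import Data.Product using (Σ; _×_; _,_; proj₁; proj₂)
open import Data.Sum using (_⊎_; inj₁; inj₂)
open import Data.Unit using (⊤; tt)
open import Data.List using (List; []; _∷_; _++_)
open import Data.List.Membership.Propositional using (_∈_)
open import Data.List.Relation.Unary.Any using (here; there)
open import Relation.Binary.PropositionalEquality
  using (_≡_; refl; sym; trans; cong; subst; module ≡-Reasoning)

module Congruence (𝒮 : Setting) where
  open Setting 𝒮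
  open Theory 𝒮

  ⊨∀-++ : ∀ {A B} {a : Hom A B} (S T : Branches A) → ⊨∀ a S → ⊨∀ a T → ⊨∀ a (S ++ T)
  ⊨∀-++ []      T _        t = t
  ⊨∀-++ (_ ∷ S) T (p , ps) t = p , ⊨∀-++ S T ps t

  ⊨∀-++⁻ : ∀ {A B} {a : Hom A B} (S T : Branches A) → ⊨∀ a (S ++ T) → ⊨∀ a S × ⊨∀ a T
  ⊨∀-++⁻ []      T t        = tt , t
  ⊨∀-++⁻ (_ ∷ S) T (p , ps) with ⊨∀-++⁻ S T ps
  ... | s , t = (p , s) , t

  ⊨∃-++ˡ : ∀ {A B} {a : Hom A B} (S T : Branches A) → ⊨∃ a S → ⊨∃ a (S ++ T)
  ⊨∃-++ˡ (_ ∷ S) T (inj₁ p) = inj₁ p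
  ⊨∃-++ˡ (_ ∷ S) T (inj₂ p) = inj₂ (⊨∃-++ˡ S T p)

  ⊨∃-++ʳ : ∀ {A B} {a : Hom A B} (S T : Branches A) → ⊨∃ a T → ⊨∃ a (S ++ T)
  ⊨∃-++ʳ []      T p = p
  ⊨∃-++ʳ (_ ∷ S) T p = inj₂ (⊨∃-++ʳ S T p)

  ⊨∃-++⁻ : ∀ {A B} {a : Hom A B} (S T : Branches A) → ⊨∃ a (S ++ T) → ⊨∃ a S ⊎ ⊨∃ a T
  ⊨∃-++⁻ []      T p        = inj₂ p
  ⊨∃-++⁻ (_ ∷ S) T (inj₁ p) = inj₁ (inj₁ p)
  ⊨∃-++⁻ (_ ∷ S) T (inj₂ p) with ⊨∃-++⁻ S T p
  ... | inj₁ q = inj₁ (inj₂ q)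
  ... | inj₂ q = inj₂ q

  Squares : Obj → Obj → Set
  Squares A' B = List (Σ Obj λ D → Hom A' D × Hom B D)

  ⊨∀-shiftκ : ∀ {A' B E} (𝒜 : Cond A') (d : Hom B E) (ks : Squares A' B) →
              (∀ {D α β} → (D , α , β) ∈ ks → ∀ g → d ≡ β ⨾ g → g ⊨ (𝒜 ↓ α)) →
              ⊨∀ d (shiftκ 𝒜 ks)
  ⊨∀-shiftκ 𝒜 d []       p = tt
  ⊨∀-shiftκ 𝒜 d (_ ∷ ks) p = p (here refl) , ⊨∀-shiftκ 𝒜 d ks (λ m → p (there m))

  ⊨∀-shiftκ⁻ : ∀ {A' B E} (𝒜 : Cond A') (d : Hom B E) (ks : Squares A' B) →
               ⊨∀ d (shiftκ 𝒜 ks) →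
               ∀ {D α β} → (D , α , β) ∈ ks → ∀ g → d ≡ β ⨾ g → g ⊨ (𝒜 ↓ α)
  ⊨∀-shiftκ⁻ 𝒜 d (_ ∷ ks) (p , ps) (here refl) = p
  ⊨∀-shiftκ⁻ 𝒜 d (_ ∷ ks) (p , ps) (there m)   = ⊨∀-shiftκ⁻ 𝒜 d ks ps m

  ⊨∃-shiftκ : ∀ {A' B E} (𝒜 : Cond A') (d : Hom B E) (ks : Squares A' B) →
              ∀ {D α β} → (D , α , β) ∈ ks → ∀ g → d ≡ β ⨾ g → g ⊨ (𝒜 ↓ α) →
              ⊨∃ d (shiftκ 𝒜 ks)
  ⊨∃-shiftκ 𝒜 d (_ ∷ ks) (here refl) g e s = inj₁ (g , e , s)
  ⊨∃-shiftκ 𝒜 d (_ ∷ ks) (there m)   g e s = inj₂ (⊨∃-shiftκ 𝒜 d ks m g e s)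

  ⊨∃-shiftκ⁻ : ∀ {A' B E} (𝒜 : Cond A') (d : Hom B E) (ks : Squares A' B) →
               ⊨∃ d (shiftκ 𝒜 ks) →
               Σ Obj λ D → Σ (Hom A' D) λ α → Σ (Hom B D) λ β →
                 (D , α , β) ∈ ks × Σ (Hom D E) λ g → d ≡ β ⨾ g × g ⊨ (𝒜 ↓ α)
  ⊨∃-shiftκ⁻ 𝒜 d (_ ∷ ks) (inj₁ (g , e , s)) = _ , _ , _ , here refl , g , e , s
  ⊨∃-shiftκ⁻ 𝒜 d (_ ∷ ks) (inj₂ p) with ⊨∃-shiftκ⁻ 𝒜 d ks p
  ... | D , α , β , m , g , e , s = D , α , β , there m , g , e , s

  paste : ∀ {A A' B D E} {h : Hom A A'} {c : Hom A B} {α : Hom A' D} {β : Hom B D}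
          {d : Hom B E} {g : Hom D E} → h ⨾ α ≡ c ⨾ β → d ≡ β ⨾ g → c ⨾ d ≡ h ⨾ (α ⨾ g)
  paste {h = h} {c} {α} {β} {d} {g} square d≡βg = begin
    c ⨾ d         ≡⟨ cong (c ⨾_) d≡βg ⟩
    c ⨾ (β ⨾ g)   ≡⟨ sym (assoc c β g) ⟩
    (c ⨾ β) ⨾ g   ≡⟨ cong (_⨾ g) (sym square) ⟩
    (h ⨾ α) ⨾ g   ≡⟨ assoc h α g ⟩
    h ⨾ (α ⨾ g)   ∎
    where open ≡-Reasoning

  -- For a ∀-branch (h , 𝒜') every shifted
  -- branch comes from a square in κ h c, which pastes to a factorisation of
  -- c ⨾ d through h; for an ∃-branch the witnessing factorisation
  -- c ⨾ d = h ⨾ g forms a commuting square, represented in κ h c.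
  mutual
    ⊨↓ : ∀ {A B E} (𝒜 : Cond A) (c : Hom A B) (d : Hom B E) → (c ⨾ d) ⊨ 𝒜 → d ⊨ (𝒜 ↓ c)
    ⊨↓ (cond ∀q S) c d p = ⊨∀↓ S c d p
    ⊨↓ (cond ∃q S) c d p = ⊨∃↓ S c d p

    ⊨∀↓ : ∀ {A B E} (S : Branches A) (c : Hom A B) (d : Hom B E) →
          ⊨∀ (c ⨾ d) S → ⊨∀ d (shiftB S c)
    ⊨∀↓ [] c d p = tt
    ⊨∀↓ ((A' , h , 𝒜') ∷ S) c d (p , ps) =
      ⊨∀-++ (shiftκ 𝒜' (κ h c)) (shiftB S c)
        (⊨∀-shiftκ 𝒜' d (κ h c) λ {_} {α} m g e →
           ⊨↓ 𝒜' α g (p (α ⨾ g) (paste (κ-commutes h c m) e)))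
        (⊨∀↓ S c d ps)

    ⊨∃↓ : ∀ {A B E} (S : Branches A) (c : Hom A B) (d : Hom B E) →
          ⊨∃ (c ⨾ d) S → ⊨∃ d (shiftB S c)
    ⊨∃↓ ((A' , h , 𝒜') ∷ S) c d (inj₁ (g , e , s)) with κ-represents h c g d (sym e)
    ... | _ , α , _ , m , γ , g≡αγ , d≡βγ =
      ⊨∃-++ˡ (shiftκ 𝒜' (κ h c)) (shiftB S c)
        (⊨∃-shiftκ 𝒜' d (κ h c) m γ d≡βγ (⊨↓ 𝒜' α γ (subst (_⊨ 𝒜') g≡αγ s)))
    ⊨∃↓ ((A' , h , 𝒜') ∷ S) c d (inj₂ p) =
      ⊨∃-++ʳ (shiftκ 𝒜' (κ h c)) (shiftB S c) (⊨∃↓ S c d p)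

  mutual
    ⊨↓⁻ : ∀ {A B E} (𝒜 : Cond A) (c : Hom A B) (d : Hom B E) → d ⊨ (𝒜 ↓ c) → (c ⨾ d) ⊨ 𝒜
    ⊨↓⁻ (cond ∀q S) c d p = ⊨∀↓⁻ S c d p
    ⊨↓⁻ (cond ∃q S) c d p = ⊨∃↓⁻ S c d p

    ⊨∀↓⁻ : ∀ {A B E} (S : Branches A) (c : Hom A B) (d : Hom B E) →
           ⊨∀ d (shiftB S c) → ⊨∀ (c ⨾ d) S
    ⊨∀↓⁻ [] c d p = tt
    ⊨∀↓⁻ ((A' , h , 𝒜') ∷ S) c d p with ⊨∀-++⁻ (shiftκ 𝒜' (κ h c)) (shiftB S c) p
    ... | pκ , ps = branch , ⊨∀↓⁻ S c d ps
      where
      branch : ∀ g → c ⨾ d ≡ h ⨾ g → g ⊨ 𝒜'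
      branch g e with κ-represents h c g d (sym e)
      ... | _ , α , _ , m , γ , g≡αγ , d≡βγ =
        subst (_⊨ 𝒜') (sym g≡αγ) (⊨↓⁻ 𝒜' α γ (⊨∀-shiftκ⁻ 𝒜' d (κ h c) pκ m γ d≡βγ))

    ⊨∃↓⁻ : ∀ {A B E} (S : Branches A) (c : Hom A B) (d : Hom B E) →
           ⊨∃ d (shiftB S c) → ⊨∃ (c ⨾ d) S
    ⊨∃↓⁻ ((A' , h , 𝒜') ∷ S) c d p with ⊨∃-++⁻ (shiftκ 𝒜' (κ h c)) (shiftB S c) p
    ... | inj₂ q = inj₂ (⊨∃↓⁻ S c d q)
    ... | inj₁ q with ⊨∃-shiftκ⁻ 𝒜' d (κ h c) q
    ...   | _ , α , _ , m , g , e , s =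
      inj₁ (α ⨾ g , paste (κ-commutes h c m) e , ⊨↓⁻ 𝒜' α g s)

  ⊫-↓ : ∀ {A B} (𝒜 ℬ : Cond A) (f : Hom A B) → 𝒜 ⊫ ℬ → (𝒜 ↓ f) ⊫ (ℬ ↓ f)
  ⊫-↓ 𝒜 ℬ f 𝒜⊫ℬ k s = ⊨↓ ℬ f k (𝒜⊫ℬ (f ⨾ k) (⊨↓⁻ 𝒜 f k s))

  ↓-⨾ : ∀ {A B E} (𝒜 : Cond A) (d : Hom A B) (f : Hom B E) → ((𝒜 ↓ d) ↓ f) ⊫ (𝒜 ↓ (d ⨾ f))
  ↓-⨾ 𝒜 d f k s =
    ⊨↓ 𝒜 (d ⨾ f) k (subst (_⊨ 𝒜) (sym (assoc d f k)) (⊨↓⁻ 𝒜 d (f ⨾ k) (⊨↓⁻ (𝒜 ↓ d) f k s)))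

  _∧_ : ∀ {A} → Cond A → Cond A → Cond A
  _∧_ {A} 𝒜 ℬ = cond ∀q ((A , idA , 𝒜) ∷ (A , idA , ℬ) ∷ [])

  ∧-intro : ∀ {A B} (𝒜 ℬ : Cond A) (k : Hom A B) → k ⊨ 𝒜 → k ⊨ ℬ → k ⊨ (𝒜 ∧ ℬ)
  ∧-intro 𝒜 ℬ k k⊨𝒜 k⊨ℬ =
    (λ g e → subst (_⊨ 𝒜) (trans e (idˡ g)) k⊨𝒜) ,
    (λ g e → subst (_⊨ ℬ) (trans e (idˡ g)) k⊨ℬ) , tt

  ∧-elimˡ : ∀ {A} (𝒜 ℬ : Cond A) → (𝒜 ∧ ℬ) ⊫ 𝒜
  ∧-elimˡ 𝒜 ℬ k (p , _) = p k (sym (idˡ k))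

  ∧-elimʳ : ∀ {A} (𝒜 ℬ : Cond A) → (𝒜 ∧ ℬ) ⊫ ℬ
  ∧-elimʳ 𝒜 ℬ k (_ , p , _) = p k (sym (idˡ k))

  step-unfold : ∀ {J K L} {a : Hom 𝟘 J} {d : Hom J K} {f : Hom K L} {𝒜 a'} →
                Step (a ⨾ d) f 𝒜 a' → Step a (d ⨾ f) 𝒜 a'
  step-unfold {a = a} {d} {f} (I , ℓ , r , ℛ , rule , c , e , e' , ent) =
    I , ℓ , r , ℛ , rule , c , trans (sym (assoc a d f)) e , e' , ent

  step-fold : ∀ {J K L} {a : Hom 𝟘 J} {d : Hom J K} {f : Hom K L} {𝒜 a'} →
              Step a (d ⨾ f) 𝒜 a' → Step (a ⨾ d) f 𝒜 a'
  step-fold {a = a} {d} {f} (I , ℓ , r , ℛ , rule , c , e , e' , ent) =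
    I , ℓ , r , ℛ , rule , c , trans (assoc a d f) e , e' , ent

  -- An answer by b to a step  a --[f, 𝒜]--> a'  ending in R, where 𝒟 is the
  -- (shifted) condition under which the answer must cover 𝒜.
  record Reply (R : CondRel) {J K} (b : Hom 𝟘 J) (f : Hom J K)
               (𝒜 𝒟 : Cond K) (a' : Hom 𝟘 K) : Set₁ where
    field
      Idx      : Set
      target   : Idx → Hom 𝟘 K
      guard    : Idx → Cond K
      residual : Idx → Cond K
      step     : ∀ i → Step b f (guard i) (target i)
      related  : ∀ i → R a' (target i) (residual i)
      covers   : ∀ {B} (k : Hom K B) → k ⊨ 𝒜 → k ⊨ 𝒟 →
                 Σ Idx λ i → k ⊨ residual i × k ⊨ guard i
  open Reply

  -- One half of the game, phrased with replies: every step of a is answered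
  -- by b.  (A record, so that its indices are inferable.)
  record Game (R : CondRel) {J} (a b : Hom 𝟘 J) (𝒞 : Cond J) : Set₁ where
    field
      play : ∀ {K} (f : Hom J K) (𝒜 : Cond K) (a' : Hom 𝟘 K) →
             Step a f 𝒜 a' → Reply R b f 𝒜 (𝒞 ↓ f) a'
  open Game

  Game⇒Answers : ∀ {R : CondRel} {J} {a b : Hom 𝟘 J} {𝒞} → Game R a b 𝒞 → Answers R a b 𝒞
  Game⇒Answers game f 𝒜 a' st = let ρ = play game f 𝒜 a' st in
    Idx ρ , target ρ , guard ρ , residual ρ , step ρ , related ρ , covers ρ

  Answers⇒Game : ∀ {R : CondRel} {J} {a b : Hom 𝟘 J} {𝒞} → Answers R a b 𝒞 → Game R a b 𝒞
  play (Answers⇒Game ans) f 𝒜 a' st with ans f 𝒜 a' st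
  ... | I , b' , ℬ , 𝒞' , st' , rel , cov = record
    { Idx = I ; target = b' ; guard = ℬ ; residual = 𝒞'
    ; step = st' ; related = rel ; covers = cov }

  _⇒_ : CondRel → CondRel → Set
  R ⇒ R' = ∀ {J} {x y : Hom 𝟘 J} {𝒞} → R x y 𝒞 → R' x y 𝒞

  converse : CondRel → CondRel
  converse R x y 𝒞 = R y x 𝒞

  reply-map : ∀ {R R' : CondRel} {J K} {b : Hom 𝟘 J} {f : Hom J K} {𝒜 𝒟 a'} →
              R ⇒ R' → Reply R b f 𝒜 𝒟 a' → Reply R' b f 𝒜 𝒟 a'
  reply-map R⇒R' ρ = record
    { Idx = Idx ρ ; target = target ρ ; guard = guard ρ ; residual = residual ρ
    ; step = step ρ ; related = λ i → R⇒R' (related ρ i) ; covers = covers ρ }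

  game-map : ∀ {R R' : CondRel} {J} {a b : Hom 𝟘 J} {𝒞} → R ⇒ R' → Game R a b 𝒞 → Game R' a b 𝒞
  play (game-map R⇒R' game) f 𝒜 a' st = reply-map R⇒R' (play game f 𝒜 a' st)

  game-bisim : ∀ {R : CondRel} → (∀ {J} {a b : Hom 𝟘 J} {𝒞} → R a b 𝒞 →
                          Game R a b 𝒞 × Game (converse R) b a 𝒞) → IsCondBisim R
  game-bisim games a b 𝒞 r = Game⇒Answers (proj₁ (games r)) , Game⇒Answers (proj₂ (games r))

  game-fwd : ∀ {R : CondRel} → IsCondBisim R → ∀ {J} {a b : Hom 𝟘 J} {𝒞} → R a b 𝒞 → Game R a b 𝒞
  game-fwd bisim {a = a} {b} {𝒞} r = Answers⇒Game (proj₁ (bisim a b 𝒞 r))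

  game-bwd : ∀ {R : CondRel} → IsCondBisim R → ∀ {J} {a b : Hom 𝟘 J} {𝒞} → R a b 𝒞 →
             Game (converse R) b a 𝒞
  game-bwd bisim {a = a} {b} {𝒞} r = Answers⇒Game (proj₂ (bisim a b 𝒞 r))

  Identity : CondRel
  Identity x y 𝒞 = x ≡ y

  game-identity : ∀ {J} (a : Hom 𝟘 J) (𝒞 : Cond J) → Game Identity a a 𝒞
  play (game-identity a 𝒞) f 𝒜 a' st = record
    { Idx = ⊤ ; target = λ _ → a' ; guard = λ _ → 𝒜 ; residual = λ _ → 𝒜
    ; step = λ _ → st ; related = λ _ → refl ; covers = λ k s _ → tt , s , s }

  identity-bisim : IsCondBisim Identity
  identity-bisim = game-bisim λ { {a = a} {𝒞 = 𝒞} refl →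
    game-identity a 𝒞 , game-map sym (game-identity a 𝒞) }

  ≃-refl : ∀ {J} (a : Hom 𝟘 J) (𝒞 : Cond J) → a ≃C a ∣ 𝒞
  ≃-refl a 𝒞 = Identity , identity-bisim , refl

  ≃-sym : ∀ {J} (a b : Hom 𝟘 J) (𝒞 : Cond J) → a ≃C b ∣ 𝒞 → b ≃C a ∣ 𝒞
  ≃-sym a b 𝒞 (R , bisim , r) =
    converse R , (λ x y 𝒟 r' → proj₂ (bisim y x 𝒟 r') , proj₁ (bisim y x 𝒟 r')) , r

  -- Entailment (rather than
  -- equality) is needed since composed residuals are conjunctions.

  record Compose (R₁ R₂ : CondRel) {J} (x z : Hom 𝟘 J) (𝒟 : Cond J) : Set where
    constructor via
    field
      middle   : Hom 𝟘 J
      𝒞₁ 𝒞₂    : Cond J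
      left     : R₁ x middle 𝒞₁
      right    : R₂ middle z 𝒞₂
      entails₁ : 𝒟 ⊫ 𝒞₁
      entails₂ : 𝒟 ⊫ 𝒞₂

  reply-compose : ∀ {R₁ R₂ : CondRel} {J K} {b c : Hom 𝟘 J} {f : Hom J K} {𝒜 𝒟 𝒟₁ 𝒟₂ a'} →
    (ρ : Reply R₁ b f 𝒜 𝒟₁ a') → (∀ i → Reply R₂ c f (guard ρ i) 𝒟₂ (target ρ i)) →
    𝒟 ⊫ 𝒟₁ → 𝒟 ⊫ 𝒟₂ → Reply (Compose R₁ R₂) c f 𝒜 𝒟 a'
  reply-compose {𝒜 = 𝒜} {𝒟} ρ σ 𝒟⊫𝒟₁ 𝒟⊫𝒟₂ = record
    { Idx = Pair
    ; target = λ { (i , j) → target (σ i) j }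
    ; guard = guard′
    ; residual = residual′
    ; step = λ { (i , j) → step (σ i) j }
    ; related = λ { (i , j) → via (target ρ i) (residual ρ i) (residual (σ i) j)
        (related ρ i) (related (σ i) j)
        (∧-elimˡ (residual ρ i) (residual (σ i) j)) (∧-elimʳ (residual ρ i) (residual (σ i) j)) }
    ; covers = cover }
    where
    Pair : Set
    Pair = Σ (Idx ρ) λ i → Idx (σ i)

    guard′ residual′ : Pair → Cond _
    guard′    (i , j) = guard (σ i) j
    residual′ (i , j) = residual ρ i ∧ residual (σ i) j

    cover : ∀ {B} (k : Hom _ B) → k ⊨ 𝒜 → k ⊨ 𝒟 →
            Σ Pair λ ij → k ⊨ residual′ ij × k ⊨ guard′ ij
    cover k k⊨𝒜 k⊨𝒟 with covers ρ k k⊨𝒜 (𝒟⊫𝒟₁ k k⊨𝒟)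
    ... | i , k⊨res , k⊨guard with covers (σ i) k k⊨guard (𝒟⊫𝒟₂ k k⊨𝒟)
    ... | j , k⊨res' , k⊨guard' =
      (i , j) , ∧-intro (residual ρ i) (residual (σ i) j) k k⊨res k⊨res' , k⊨guard'

  game-compose : ∀ {R₁ R₂ : CondRel} {J} {a b c : Hom 𝟘 J} {𝒞₁ 𝒞₂ 𝒟} →
    Game R₁ a b 𝒞₁ → Game R₂ b c 𝒞₂ → 𝒟 ⊫ 𝒞₁ → 𝒟 ⊫ 𝒞₂ → Game (Compose R₁ R₂) a c 𝒟
  play (game-compose {𝒞₁ = 𝒞₁} {𝒞₂} {𝒟} game₁ game₂ 𝒟⊫𝒞₁ 𝒟⊫𝒞₂) f 𝒜 a' st =
    let ρ = play game₁ f 𝒜 a' st in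
    reply-compose ρ (λ i → play game₂ f (guard ρ i) (target ρ i) (step ρ i))
      (⊫-↓ 𝒟 𝒞₁ f 𝒟⊫𝒞₁) (⊫-↓ 𝒟 𝒞₂ f 𝒟⊫𝒞₂)

  compose-converse : ∀ {R₁ R₂ : CondRel} →
                     Compose (converse R₂) (converse R₁) ⇒ converse (Compose R₁ R₂)
  compose-converse (via y 𝒞₂ 𝒞₁ r₂ r₁ 𝒟⊫𝒞₂ 𝒟⊫𝒞₁) = via y 𝒞₁ 𝒞₂ r₁ r₂ 𝒟⊫𝒞₁ 𝒟⊫𝒞₂

  compose-bisim : ∀ {R₁ R₂ : CondRel} →
                  IsCondBisim R₁ → IsCondBisim R₂ → IsCondBisim (Compose R₁ R₂)
  compose-bisim bisim₁ bisim₂ = game-bisim λ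
    { (via _ _ _ r₁ r₂ 𝒟⊫𝒞₁ 𝒟⊫𝒞₂) →
      game-compose (game-fwd bisim₁ r₁) (game-fwd bisim₂ r₂) 𝒟⊫𝒞₁ 𝒟⊫𝒞₂ ,
      game-map compose-converse
        (game-compose (game-bwd bisim₂ r₂) (game-bwd bisim₁ r₁) 𝒟⊫𝒞₂ 𝒟⊫𝒞₁) }

  ≃-trans : ∀ {J} (a b c : Hom 𝟘 J) (𝒞 : Cond J) → a ≃C b ∣ 𝒞 → b ≃C c ∣ 𝒞 → a ≃C c ∣ 𝒞
  ≃-trans a b c 𝒞 (R₁ , bisim₁ , r₁) (R₂ , bisim₂ , r₂) =
    Compose R₁ R₂ , compose-bisim bisim₁ bisim₂ , via b 𝒞 𝒞 r₁ r₂ (λ k s → s) (λ k s → s)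

  -- A step of a ⨾ d with f is a
  -- step of a with d ⨾ f, whose answers by b are answers by b ⨾ d with f.

  data Contextual (R : CondRel) {K} : Hom 𝟘 K → Hom 𝟘 K → Cond K → Set where
    base   : ∀ {x y 𝒞} → R x y 𝒞 → Contextual R x y 𝒞
    extend : ∀ {J} {a b : Hom 𝟘 J} {𝒞} (d : Hom J K) → R a b 𝒞 →
             Contextual R (a ⨾ d) (b ⨾ d) (𝒞 ↓ d)

  reply-context : ∀ {R : CondRel} {J K L} {b : Hom 𝟘 J} (d : Hom J K) {f : Hom K L}
                  (𝒞 : Cond J) {𝒜 a'} →
    Reply R b (d ⨾ f) 𝒜 (𝒞 ↓ (d ⨾ f)) a' → Reply R (b ⨾ d) f 𝒜 ((𝒞 ↓ d) ↓ f) a'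
  reply-context {b = b} d {f} 𝒞 ρ = record
    { Idx = Idx ρ ; target = target ρ ; guard = guard ρ ; residual = residual ρ
    ; related = related ρ
    ; step = λ i → step-fold {a = b} {d = d} {𝒜 = guard ρ i} (step ρ i)
    ; covers = λ k k⊨𝒜 k⊨𝒞↓d↓f → covers ρ k k⊨𝒜 (↓-⨾ 𝒞 d f k k⊨𝒞↓d↓f) }

  game-context : ∀ {R : CondRel} {J K} {a b : Hom 𝟘 J} {𝒞} (d : Hom J K) →
                 Game R a b 𝒞 → Game R (a ⨾ d) (b ⨾ d) (𝒞 ↓ d)
  play (game-context {a = a} {𝒞 = 𝒞} d game) f 𝒜 a' st =
    reply-context d 𝒞 (play game (d ⨾ f) 𝒜 a' (step-unfold {a = a} {d = d} {𝒜 = 𝒜} st))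

  contextual-bisim : ∀ {R : CondRel} → IsCondBisim R → IsCondBisim (Contextual R)
  contextual-bisim bisim = game-bisim λ
    { (base r) → game-map base (game-fwd bisim r) , game-map base (game-bwd bisim r)
    ; (extend d r) → game-map base (game-context d (game-fwd bisim r)) ,
                     game-map base (game-context d (game-bwd bisim r)) }

  ≃-ctx : ∀ {J K} (a b : Hom 𝟘 J) (𝒞 : Cond J) (d : Hom J K) →
          a ≃C b ∣ 𝒞 → (a ⨾ d) ≃C (b ⨾ d) ∣ (𝒞 ↓ d)
  ≃-ctx a b 𝒞 d (R , bisim , r) =
    Contextual R , contextual-bisim bisim , extend d r

lemma4p11 : (𝒮 : Setting) → Theory.IsCondCongruence 𝒮
lemma4p11 𝒮 = record
  { refl′  = ≃-refl
  ; sym′   = ≃-sym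
  ; trans′ = ≃-trans
  ; ctx    = ≃-ctx }
  where open Congruence 𝒮
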